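{- Let $m,n\ge1$, $\nu=(NE^m)^n$, and let $\mathcal D^{\mathrm{out}}_{n,m}$ be the set of $m$-Dyck paths of height $n$ whose out-degree in the $\nu$-Tamari poset is maximal. Then the map $\varphi:\mathcal D^{\mathrm{out}}_{n,m}\to\mathcal D_{n,m-1}$ sending $D$ to the $(m-1)$-Dyck path of height $n$ with left area vector $\mathbf{LA}_{\varphi(D)}=\mathbf{LA}_D-(0,1,2,\dots,n-1)$ (i.e. $\mathbf{LA}_D-\mathbf{LA}_{\xi_\nu}$, with $\xi_\nu$ the maximal staircase shape $\nu$-Dyck path) is a well-defined bijection which is order preserving for the $\nu$-Tamari orders (the order on $\mathcal D^{\mathrm{out}}_{n,m}$ being the restriction of the $(NE^m)^n$-Tamari order, and on $\mathcal D_{n,m-1}$ the $(NE^{m-1})^n$-Tamari order).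
   Context: For $k\ge0$ and $\nu=(NE^k)^n$ (a path from $(0,0)$ to $(kn,n)$ with unit north steps $N$ and east steps $E$), a $k$-Dyck path of height $n$ is a lattice path from $(0,0)$ to $(kn,n)$ with $N$ and $E$ steps lying weakly above $\nu$; $\mathcal D_{n,k}$ is the set of them. For such $D$ and $i\in[n]$, $r_i^D$ is the point immediately before its $i$-th north step; the left area vector is $\mathbf{LA}_D=(x_1,\dots,x_n)$ with $x_i$ the $x$-coordinate of $r_i^D$ (a path is determined by it). For $p=(x,y)$ on $D$, $\mathrm{horiz}(p)=X(y)-x$ with $X(y)$ the largest $x$-coordinate of a point of $\nu$ at height $y$. The touch point $t_i^D$ is the first point of $D$ after $r_i^D$ with the same horizontal distance as $r_i^D$. If $r_i^D$ is preceded by an east step, write $D=dEtf$ ($dE$ = subpath from $(0,0)$ to $r_i^D$, $t$ = subpath from $r_i^D$ to $t_i^D$, $f$ = the rest) and set $D\uparrow_i=dtEf$. The $\nu$-Tamari order is the partial order on $\mathcal D_{n,k}$ whose cover relations are $D\lessdot D\uparrow_i$ whenever defined; the out-degree of $D$ is the number of elements covering $D$. A staircase shape of size $s$ is a path $N^a(EN)^sE^b$, $a,b\ge0$; the maximal staircase shape $\nu$-Dyck path is such a $\nu$-Dyck path of largest size. -}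

module Defs where

open import Data.Nat using (ℕ; zero; suc; _+_; _*_; _∸_; _≤_)
open import Data.Integer as ℤ using (ℤ; +_; _-_)
open import Data.List using (List; []; _∷_; _++_; take; length; map; upTo; zipWith)
open import Data.List.Membership.Propositional using (_∈_)
open import Data.List.Relation.Unary.Unique.Propositional using (Unique)
open import Data.Product using (Σ; ∃; _×_; _,_; proj₁)
open import Function.Bundles using (_⇔_)
open import Relation.Binary.PropositionalEquality using (_≡_; _≢_)
open import Relation.Binary.Construct.Closure.ReflexiveTransitive using (Star)

data Step : Set where
  N E : Step

Path : Set
Path = List Step

-- number of north / east steps (= y / x coordinate of the endpoint)
#N : Path → ℕ
#N []      = 0
#N (N ∷ p) = suc (#N p)
#N (E ∷ p) = #N p

#E : Path → ℕ
#E []      = 0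
#E (N ∷ p) = #E p
#E (E ∷ p) = suc (#E p)

-- For ν = (N E^k)^n, the largest x-coordinate of ν at height y is X(y) = k*y.
-- horiz(p) = X(y) - x for the endpoint p = (x,y) of a prefix of a path.
horiz : ℕ → Path → ℤ
horiz k p = + (k * #N p) - + (#E p)

-- D is a k-Dyck path of height n: ends at (kn, n) and every lattice point (x,y)
-- of D (= endpoint of a prefix) lies weakly above ν, i.e. x ≤ X(y) = k*y.
Dyck : ℕ → ℕ → Path → Set
Dyck k n D = #N D ≡ n × #E D ≡ k * n × (∀ j → #E (take j D) ≤ k * #N (take j D))

-- Left area vector: x-coordinates of the points immediately before each north step.
LA-go : ℕ → Path → List ℕ
LA-go x []      = []
LA-go x (N ∷ p) = x ∷ LA-go x p
LA-go x (E ∷ p) = LA-go (suc x) p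

LA : Path → List ℕ
LA = LA-go 0

-- With s = dE (the subpath from (0,0) to r_i^D), t is the subpath from r_i^D to
-- the touch point t_i^D: r_i^D is immediately before a north step (t starts
-- with N), the endpoint of t has the same horizontal distance as r_i^D, and no
-- point of D strictly between r_i^D and that endpoint does.
IsTouchSegment : ℕ → Path → Path → Set
IsTouchSegment k s t =
  (∃ λ t′ → t ≡ N ∷ t′) ×
  horiz k (s ++ t) ≡ horiz k s ×
  (∀ u v → t ≡ u ++ v → u ≢ [] → v ≢ [] → horiz k (s ++ u) ≢ horiz k s)

-- Cover relation of the ν-Tamari order for ν = (N E^k)^n:  D ⋖ D↑_i,
-- where D = d E t f and D↑_i = d t E f.
Cover : ℕ → Path → Path → Set
Cover k D D′ = Σ Path λ d → Σ Path λ t → Σ Path λ f →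
  D ≡ d ++ (E ∷ t ++ f) ×
  D′ ≡ d ++ (t ++ (E ∷ f)) ×
  IsTouchSegment k (d ++ (E ∷ [])) t

TamariLeq : ℕ → Path → Path → Set
TamariLeq k = Star (Cover k)

-- D has out-degree c: the set of elements covering D has exactly c elements
-- (witnessed by a duplicate-free list enumerating it).
HasOutDegree : ℕ → Path → ℕ → Set
HasOutDegree k D c = Σ (List Path) λ L →
  Unique L × (∀ D′ → (D′ ∈ L) ⇔ Cover k D D′) × length L ≡ c

MaxOutDegree : ℕ → ℕ → Path → Set
MaxOutDegree k n D = Dyck k n D × Σ ℕ λ c → HasOutDegree k D c ×
  (∀ D′ c′ → Dyck k n D′ → HasOutDegree k D′ c′ → c′ ≤ c)

DOut : ℕ → ℕ → Set
DOut k n = Σ Path (MaxOutDegree k n)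

DPaths : ℕ → ℕ → Set
DPaths k n = Σ Path (Dyck k n)

-- (0,1,...,n-1) as integers  (= LA of the maximal staircase shape ν-Dyck path)
stairℤ : ℕ → List ℤ
stairℤ n = map +_ (upTo n)

LAℤ : Path → List ℤ
LAℤ D = map +_ (LA D)

{-# OPTIONS --safe #-}
-- Inserting an E after every N ("stretching") maps k-Dyck paths of height n bijectively
-- onto the (k+1)-Dyck paths in which every N is followed by an E, and adds (0, 1, …, n−1)
-- to the left area vector. A cover of D is a rotation at a valley E N of D, whose touch
-- point is where the horizontal distance first returns to its value (FirstReturn); on a
-- Dyck path every valley has one, so the out-degree is the number of valleys. A Dyck path
-- of height n ≥ 1 has at most n − 1 valleys, with equality exactly when every N but the
-- first is preceded by E and the path does not end with N, i.e. when it is stretched. So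
-- the paths of maximal out-degree are the stretched ones and φ unstretches. Finally, a
-- first return of slope k + 1 inside a stretched path is a stretched first return of
-- slope k, so a cover ending in a stretched path starts in one and unstretches to a cover.
module Submission where

open import Defs
open import Data.Nat using (ℕ; _≤_; _∸_)
open import Data.Integer using (_-_)
open import Data.List using (zipWith)
open import Data.Product using (Σ; ∃; _×_; proj₁)
open import Relation.Binary.PropositionalEquality using (_≡_)

open import Data.Empty using (⊥-elim)
open import Data.Integer as ℤ using (+_; 0ℤ)
open import Data.Integer.Properties using (pos-+; +-injective; i-j≡0⇒i≡j; i≡j⇒i-j≡0)
import Data.Integer.Properties as ℤP
open import Algebra.Properties.AbelianGroup ℤP.+-0-abelianGroup using (identityʳ-unique)
open import Data.Integer.Tactic.RingSolver using (solve-∀)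
open import Data.List using (List; []; _∷_; _++_; map; length; [_]; replicate; take; applyUpTo)
open import Data.List.Membership.Propositional using (_∈_)
open import Data.List.Membership.Propositional.Properties using (∈-map⁺; ∈-map⁻; ∈-++⁺ˡ; ∈-++⁺ʳ; ∈-++⁻; ∈-∃++)
open import Data.List.Properties using (∷-injective; ∷-injectiveʳ; length-++; length-map; length-++-sucʳ)
import Data.List.Relation.Unary.All as All
open import Data.List.Relation.Unary.AllPairs using ([]; _∷_)
open import Data.List.Relation.Unary.Any using (here; there)
open import Data.List.Relation.Unary.Unique.Propositional using (Unique)
import Data.List.Relation.Unary.Unique.Propositional.Properties as Unique
open import Data.Nat using (zero; suc; _+_; _*_; z≤n; s≤s; s≤s⁻¹; pred)
open import Data.Nat.Properties
  using ( +-assoc; +-comm; +-suc; +-identityʳ; *-suc; *-zeroʳ; *-distribˡ-+; suc-injective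
        ; +-cancelʳ-≡; +-cancelˡ-≤; +-monoʳ-≤; +-monoˡ-≤; *-monoʳ-≤
        ; ≤-antisym; ≤-trans; ≤-reflexive; n≤1+n; m≤n⇒m≤1+n; <-irrefl; module ≤-Reasoning)
open import Data.Product using (_,_; proj₂; ∃₂)
open import Data.Sum using (inj₁; inj₂)
open import Function.Bundles using (_⇔_; mk⇔; Equivalence)
open import Relation.Binary.Construct.Closure.ReflexiveTransitive using (ε; _◅_)
open import Relation.Binary.PropositionalEquality
  using (refl; sym; trans; cong; cong₂; subst; subst₂; _≢_; module ≡-Reasoning)
open import Relation.Nullary using (Dec; yes; no; ¬_)
import Relation.Nullary.Decidable as Dec

open Equivalence using (to; from)

#N-++ : ∀ a b → #N (a ++ b) ≡ #N a + #N b
#N-++ []      b = refl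
#N-++ (N ∷ a) b = cong suc (#N-++ a b)
#N-++ (E ∷ a) b = #N-++ a b

#E-++ : ∀ a b → #E (a ++ b) ≡ #E a + #E b
#E-++ []      b = refl
#E-++ (N ∷ a) b = #E-++ a b
#E-++ (E ∷ a) b = cong suc (#E-++ a b)

horiz-++ : ∀ k s u → horiz k (s ++ u) ≡ horiz k s ℤ.+ horiz k u
horiz-++ k s u = begin
  + (k * #N (s ++ u)) - + #E (s ++ u)
    ≡⟨ cong₂ (λ a b → + (k * a) - + b) (#N-++ s u) (#E-++ s u) ⟩
  + (k * (#N s + #N u)) - + (#E s + #E u)
    ≡⟨ cong₂ (λ a b → + a - b) (*-distribˡ-+ k (#N s) (#N u)) (pos-+ (#E s) (#E u)) ⟩
  + (k * #N s + k * #N u) - (+ #E s ℤ.+ + #E u)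
    ≡⟨ cong (λ a → a - (+ #E s ℤ.+ + #E u)) (pos-+ (k * #N s) (k * #N u)) ⟩
  (+ (k * #N s) ℤ.+ + (k * #N u)) - (+ #E s ℤ.+ + #E u)
    ≡⟨ regroup (+ (k * #N s)) (+ (k * #N u)) (+ #E s) (+ #E u) ⟩
  horiz k s ℤ.+ horiz k u ∎
  where
  open ≡-Reasoning
  regroup : ∀ a b c d → (a ℤ.+ b) - (c ℤ.+ d) ≡ (a - c) ℤ.+ (b - d)
  regroup = solve-∀

horiz≡0⇔ : ∀ k u → horiz k u ≡ 0ℤ ⇔ k * #N u ≡ #E u
horiz≡0⇔ k u = mk⇔ (λ h → +-injective (i-j≡0⇒i≡j _ _ h)) (λ h → i≡j⇒i-j≡0 (cong +_ h))

horiz-++-≡⇔ : ∀ k s u → horiz k (s ++ u) ≡ horiz k s ⇔ k * #N u ≡ #E u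
horiz-++-≡⇔ k s u = mk⇔
  (λ h → horiz≡0⇔ k u .to
    (identityʳ-unique (horiz k s) (horiz k u) (trans (sym (horiz-++ k s u)) h)))
  (λ h → trans (horiz-++ k s u)
    (trans (cong (λ j → horiz k s ℤ.+ j) (horiz≡0⇔ k u .from h)) (ℤP.+-identityʳ (horiz k s))))

horiz-N∷-≡⇔ : ∀ k s u → horiz k (s ++ N ∷ u) ≡ horiz k s ⇔ k + k * #N u ≡ #E u
horiz-N∷-≡⇔ k s u = mk⇔
  (λ h → trans (sym (*-suc k (#N u))) (horiz-++-≡⇔ k s (N ∷ u) .to h))
  (λ h → horiz-++-≡⇔ k s (N ∷ u) .from (trans (*-suc k (#N u)) h))

-- First returns and touch points

-- Along a path, the horizontal distance to ν grows by k at each north step and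
-- drops by 1 at each east step; FirstReturn k e u says that u, started at distance e,
-- ends exactly when this distance first becomes 0.
data FirstReturn (k : ℕ) : ℕ → Path → Set where
  []  : FirstReturn k 0 []
  N∷_ : ∀ {e u} → FirstReturn k (suc e + k) u → FirstReturn k (suc e) (N ∷ u)
  E∷_ : ∀ {e u} → FirstReturn k e u → FirstReturn k (suc e) (E ∷ u)

+-*-suc : ∀ e k n → e + k * suc n ≡ e + k + k * n
+-*-suc e k n = trans (cong (λ x → e + x) (*-suc k n)) (sym (+-assoc e k (k * n)))

FirstReturn-balanced : ∀ {k e u} → FirstReturn k e u → e + k * #N u ≡ #E u
FirstReturn-balanced {k}         []              = *-zeroʳ k
FirstReturn-balanced {k} {suc e} (N∷_ {u = u} r) = trans (+-*-suc (suc e) k (#N u)) (FirstReturn-balanced r)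
FirstReturn-balanced             (E∷ r)          = cong suc (FirstReturn-balanced r)

FirstReturn-minimal : ∀ {k e u} → FirstReturn k e u →
  ∀ u₁ u₂ → u ≡ u₁ ++ u₂ → u₂ ≢ [] → e + k * #N u₁ ≢ #E u₁
FirstReturn-minimal []     [] u₂ refl u₂≢[] _ = u₂≢[] refl
FirstReturn-minimal (N∷ r) [] u₂ _    _     ()
FirstReturn-minimal (E∷ r) [] u₂ _    _     ()
FirstReturn-minimal {k} {suc e} (N∷ r) (x ∷ u₁) u₂ eq u₂≢[] h with ∷-injective eq
... | refl , eq′ = FirstReturn-minimal r u₁ u₂ eq′ u₂≢[] (trans (sym (+-*-suc (suc e) k (#N u₁))) h)
FirstReturn-minimal (E∷ r) (x ∷ u₁) u₂ eq u₂≢[] h with ∷-injective eq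
... | refl , eq′ = FirstReturn-minimal r u₁ u₂ eq′ u₂≢[] (suc-injective h)

FirstReturn-intro : ∀ {k} e u → e + k * #N u ≡ #E u →
  (∀ u₁ u₂ → u ≡ u₁ ++ u₂ → u₂ ≢ [] → e + k * #N u₁ ≢ #E u₁) → FirstReturn k e u
FirstReturn-intro     zero    []      _   _   = []
FirstReturn-intro {k} zero    (x ∷ u) _   min = ⊥-elim (min [] (x ∷ u) refl (λ ()) (*-zeroʳ k))
FirstReturn-intro     (suc e) []      ()  _
FirstReturn-intro {k} (suc e) (N ∷ u) bal min = N∷ FirstReturn-intro (suc e + k) u
  (trans (sym (+-*-suc (suc e) k (#N u))) bal)
  (λ u₁ u₂ eq ne h → min (N ∷ u₁) u₂ (cong (N ∷_) eq) ne (trans (+-*-suc (suc e) k (#N u₁)) h))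
FirstReturn-intro     (suc e) (E ∷ u) bal min = E∷ FirstReturn-intro e u (suc-injective bal)
  (λ u₁ u₂ eq ne h → min (E ∷ u₁) u₂ (cong (E ∷_) eq) ne (cong suc h))

IsTouchSegment⇔FirstReturn : ∀ k s t → IsTouchSegment k s (N ∷ t) ⇔ FirstReturn k k t
IsTouchSegment⇔FirstReturn k s t = mk⇔ touch⇒return return⇒touch
  where
  touch⇒return : IsTouchSegment k s (N ∷ t) → FirstReturn k k t
  touch⇒return (_ , returns , minimal) = FirstReturn-intro k t
    (horiz-N∷-≡⇔ k s t .to returns)
    (λ u₁ u₂ eq u₂≢[] h → minimal (N ∷ u₁) u₂ (cong (N ∷_) eq) (λ ()) u₂≢[] (horiz-N∷-≡⇔ k s u₁ .from h))

  return⇒touch : FirstReturn k k t → IsTouchSegment k s (N ∷ t)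
  return⇒touch r = (t , refl) , horiz-N∷-≡⇔ k s t .from (FirstReturn-balanced r) , minimal
    where
    minimal : ∀ u v → N ∷ t ≡ u ++ v → u ≢ [] → v ≢ [] → horiz k (s ++ u) ≢ horiz k s
    minimal []       v _  u≢[] _    _ = u≢[] refl
    minimal (x ∷ u₁) v eq _    v≢[] h with ∷-injective eq
    ... | refl , eq′ = FirstReturn-minimal r u₁ v eq′ v≢[] (horiz-N∷-≡⇔ k s u₁ .to h)

IsTouchSegment-prefix : ∀ k s s′ {t} → IsTouchSegment k s t → IsTouchSegment k s′ t
IsTouchSegment-prefix k s s′ touch@((t′ , refl) , _) =
  IsTouchSegment⇔FirstReturn k s′ t′ .from (IsTouchSegment⇔FirstReturn k s t′ .to touch)

HasFirstReturn : ℕ → ℕ → Path → Set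
HasFirstReturn k e r = ∃₂ λ u v → r ≡ u ++ v × FirstReturn k e u

HasFirstReturn-N∷ : ∀ k e r → HasFirstReturn k (suc e + k) r ⇔ HasFirstReturn k (suc e) (N ∷ r)
HasFirstReturn-N∷ k e r = mk⇔
  (λ { (u , v , refl , ρ) → N ∷ u , v , refl , N∷ ρ })
  (λ { (N ∷ u , v , eq , N∷ ρ) → u , v , ∷-injectiveʳ eq , ρ ; (E ∷ u , v , () , _) })

HasFirstReturn-E∷ : ∀ k e r → HasFirstReturn k e r ⇔ HasFirstReturn k (suc e) (E ∷ r)
HasFirstReturn-E∷ k e r = mk⇔
  (λ { (u , v , refl , ρ) → E ∷ u , v , refl , E∷ ρ })
  (λ { (E ∷ u , v , eq , E∷ ρ) → u , v , ∷-injectiveʳ eq , ρ ; (N ∷ u , v , () , _) })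

hasFirstReturn? : ∀ k e r → Dec (HasFirstReturn k e r)
hasFirstReturn? k zero    r       = yes ([] , r , refl , [])
hasFirstReturn? k (suc e) []      = no λ { ([] , _ , _ , ()) ; (_ ∷ _ , _ , () , _) }
hasFirstReturn? k (suc e) (N ∷ r) = Dec.map (HasFirstReturn-N∷ k e r) (hasFirstReturn? k (suc e + k) r)
hasFirstReturn? k (suc e) (E ∷ r) = Dec.map (HasFirstReturn-E∷ k e r) (hasFirstReturn? k e r)

hasFirstReturn : ∀ k e r → e + k * #N r ≤ #E r → HasFirstReturn k e r
hasFirstReturn k zero    r       _ = [] , r , refl , []
hasFirstReturn k (suc e) []      ()
hasFirstReturn k (suc e) (N ∷ r) h = HasFirstReturn-N∷ k e r .to
  (hasFirstReturn k (suc e + k) r (subst (_≤ #E r) (+-*-suc (suc e) k (#N r)) h))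
hasFirstReturn k (suc e) (E ∷ r) h = HasFirstReturn-E∷ k e r .to (hasFirstReturn k e r (s≤s⁻¹ h))

FirstReturn-unique : ∀ {k e u u′ v v′} → FirstReturn k e u → FirstReturn k e u′ →
  u ++ v ≡ u′ ++ v′ → u ≡ u′ × v ≡ v′
FirstReturn-unique []     []      eq = refl , eq
FirstReturn-unique (N∷ ρ) (N∷ ρ′) eq with FirstReturn-unique ρ ρ′ (∷-injectiveʳ eq)
... | refl , v≡v′ = refl , v≡v′
FirstReturn-unique (E∷ ρ) (E∷ ρ′) eq with FirstReturn-unique ρ ρ′ (∷-injectiveʳ eq)
... | refl , v≡v′ = refl , v≡v′
FirstReturn-unique (N∷ ρ) (E∷ ρ′) ()
FirstReturn-unique (E∷ ρ) (N∷ ρ′) ()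

-- Covers as rotations at valleys

data Rotation (k : ℕ) : Path → Path → Set where
  here : ∀ {u v} → FirstReturn k k u → Rotation k (E ∷ N ∷ u ++ v) (N ∷ u ++ E ∷ v)
  _∷_  : ∀ x {D D′} → Rotation k D D′ → Rotation k (x ∷ D) (x ∷ D′)

rotation-at : ∀ {k} d {u v} → FirstReturn k k u →
  Rotation k (d ++ E ∷ N ∷ u ++ v) (d ++ N ∷ u ++ E ∷ v)
rotation-at []      r = here r
rotation-at (x ∷ d) r = x ∷ rotation-at d r

Cover⇔Rotation : ∀ k D D′ → Cover k D D′ ⇔ Rotation k D D′
Cover⇔Rotation k D D′ = mk⇔ cover⇒rotation rotation⇒cover
  where
  cover⇒rotation : ∀ {D D′} → Cover k D D′ → Rotation k D D′
  cover⇒rotation (d , _ , _ , refl , refl , touch@((t , refl) , _)) =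
    rotation-at d (IsTouchSegment⇔FirstReturn k (d ++ E ∷ []) t .to touch)

  rotation⇒cover : ∀ {D D′} → Rotation k D D′ → Cover k D D′
  rotation⇒cover (here {u} r) =
    [] , N ∷ u , _ , refl , refl , IsTouchSegment⇔FirstReturn k (E ∷ []) u .from r
  rotation⇒cover (x ∷ ρ) with rotation⇒cover ρ
  ... | d , t , f , refl , refl , touch =
    x ∷ d , t , f , refl , refl , IsTouchSegment-prefix k (d ++ E ∷ []) ((x ∷ d) ++ E ∷ []) touch

rotationsAtHead : ℕ → Path → List Path
rotationsAtHead k (E ∷ N ∷ r) with hasFirstReturn? k k r
... | yes (u , v , _) = [ N ∷ u ++ E ∷ v ]
... | no _            = []
rotationsAtHead k _ = []

rotations : ℕ → Path → List Path
rotations k []      = []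
rotations k (x ∷ D) = rotationsAtHead k (x ∷ D) ++ map (x ∷_) (rotations k D)

rotationsAtHead-sound : ∀ k D {D′} → D′ ∈ rotationsAtHead k D →
  ∃₂ λ u v → FirstReturn k k u × D ≡ E ∷ N ∷ u ++ v × D′ ≡ N ∷ u ++ E ∷ v
rotationsAtHead-sound k (E ∷ N ∷ r) p with hasFirstReturn? k k r
rotationsAtHead-sound k (E ∷ N ∷ r) (here refl) | yes (u , v , refl , ρ) = u , v , ρ , refl , refl
rotationsAtHead-sound k (E ∷ N ∷ r) () | no _
rotationsAtHead-sound k (N ∷ _) ()
rotationsAtHead-sound k (E ∷ []) ()
rotationsAtHead-sound k (E ∷ E ∷ _) ()

rotations-sound : ∀ k D {D′} → D′ ∈ rotations k D → Rotation k D D′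
rotations-sound k (x ∷ D) p with ∈-++⁻ (rotationsAtHead k (x ∷ D)) p
... | inj₁ q with rotationsAtHead-sound k (x ∷ D) q
...   | _ , _ , ρ , refl , refl = here ρ
rotations-sound k (x ∷ D) p | inj₂ q with ∈-map⁻ (x ∷_) q
...   | _ , q′ , refl = x ∷ rotations-sound k D q′

rotations-complete : ∀ {k D D′} → Rotation k D D′ → D′ ∈ rotations k D
rotations-complete {k} (here {u} {v} ρ) = ∈-++⁺ˡ head
  where
  head : N ∷ u ++ E ∷ v ∈ rotationsAtHead k (E ∷ N ∷ u ++ v)
  head with hasFirstReturn? k k (u ++ v)
  ... | yes (u′ , v′ , eq , ρ′) with FirstReturn-unique ρ ρ′ eq
  ...   | refl , refl = here refl
  head | no ¬h = ⊥-elim (¬h (u , v , refl , ρ))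
rotations-complete {k} (_∷_ x {D} ρ) =
  ∈-++⁺ʳ (rotationsAtHead k (x ∷ D)) (∈-map⁺ (x ∷_) (rotations-complete ρ))

rotationsAtHead-unique : ∀ k D → Unique (rotationsAtHead k D)
rotationsAtHead-unique k (E ∷ N ∷ r) with hasFirstReturn? k k r
... | yes _ = All.[] ∷ []
... | no _  = []
rotationsAtHead-unique k []          = []
rotationsAtHead-unique k (N ∷ _)     = []
rotationsAtHead-unique k (E ∷ [])    = []
rotationsAtHead-unique k (E ∷ E ∷ _) = []

rotations-unique : ∀ k D → Unique (rotations k D)
rotations-unique k []      = []
rotations-unique k (x ∷ D) = Unique.++⁺ (rotationsAtHead-unique k (x ∷ D))
  (Unique.map⁺ ∷-injectiveʳ (rotations-unique k D)) disjoint
  where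
  disjoint : ∀ {D′} → ¬ (D′ ∈ rotationsAtHead k (x ∷ D) × D′ ∈ map (x ∷_) (rotations k D))
  disjoint (p , q) with rotationsAtHead-sound k (x ∷ D) p | ∈-map⁻ (x ∷_) q
  ... | _ , _ , _ , refl , refl | _ , _ , ()

-- Out-degree and valleys

valleys : Path → ℕ
valleys []          = 0
valleys (E ∷ N ∷ p) = suc (valleys (N ∷ p))
valleys (_ ∷ p)     = valleys p

-- Read backwards, D stays weakly below ν; on a Dyck path this makes every valley rotatable.
SuffixBound : ℕ → Path → Set
SuffixBound k D = ∀ a b → D ≡ a ++ b → k * #N b ≤ #E b

SuffixBound-∷ : ∀ k {x D} → SuffixBound k (x ∷ D) → SuffixBound k D
SuffixBound-∷ k {x} h a b eq = h (x ∷ a) b (cong (x ∷_) eq)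

take-length-++ : ∀ (a b : Path) → take (length a) (a ++ b) ≡ a
take-length-++ []      b = refl
take-length-++ (x ∷ a) b = cong (x ∷_) (take-length-++ a b)

Dyck⇒SuffixBound : ∀ k {n D} → Dyck k n D → SuffixBound k D
Dyck⇒SuffixBound k {n} (hN , hE , h) a b refl = +-cancelˡ-≤ (k * #N a) _ _ (begin
  k * #N a + k * #N b  ≡⟨ sym (*-distribˡ-+ k (#N a) (#N b)) ⟩
  k * (#N a + #N b)    ≡⟨ cong (k *_) (sym (#N-++ a b)) ⟩
  k * #N (a ++ b)      ≡⟨ cong (k *_) hN ⟩
  k * n                ≡⟨ sym hE ⟩
  #E (a ++ b)          ≡⟨ #E-++ a b ⟩
  #E a + #E b          ≤⟨ +-monoˡ-≤ (#E b) prefix ⟩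
  k * #N a + #E b      ∎)
  where
  open ≤-Reasoning
  prefix : #E a ≤ k * #N a
  prefix = subst (λ p → #E p ≤ k * #N p) (take-length-++ a b) (h (length a))

length-rotationsAtHead : ∀ k r → HasFirstReturn k k r → length (rotationsAtHead k (E ∷ N ∷ r)) ≡ 1
length-rotationsAtHead k r h with hasFirstReturn? k k r
... | yes _ = refl
... | no ¬h = ⊥-elim (¬h h)

length-rotations : ∀ k D → SuffixBound k D → length (rotations k D) ≡ valleys D
length-rotations k []          _ = refl
length-rotations k (N ∷ D)     h =
  trans (length-map (N ∷_) (rotations k D)) (length-rotations k D (SuffixBound-∷ k h))
length-rotations k (E ∷ [])    _ = refl
length-rotations k (E ∷ E ∷ D) h =
  trans (length-map (E ∷_) (rotations k (E ∷ D))) (length-rotations k (E ∷ D) (SuffixBound-∷ k h))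
length-rotations k (E ∷ N ∷ D) h = begin
  length (rotationsAtHead k (E ∷ N ∷ D) ++ map (E ∷_) (rotations k (N ∷ D)))
    ≡⟨ length-++ (rotationsAtHead k (E ∷ N ∷ D)) ⟩
  length (rotationsAtHead k (E ∷ N ∷ D)) + length (map (E ∷_) (rotations k (N ∷ D)))
    ≡⟨ cong₂ _+_ (length-rotationsAtHead k D valley) (length-map (E ∷_) (rotations k (N ∷ D))) ⟩
  suc (length (rotations k (N ∷ D)))
    ≡⟨ cong suc (length-rotations k (N ∷ D) (SuffixBound-∷ k h)) ⟩
  suc (valleys (N ∷ D)) ∎
  where
  open ≡-Reasoning
  valley : HasFirstReturn k k D
  valley = hasFirstReturn k k D (subst (_≤ #E D) (*-suc k (#N D)) (h (E ∷ []) (N ∷ D) refl))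

Unique⇒length-≤ : ∀ {A : Set} {xs ys : List A} → Unique xs → (∀ {x} → x ∈ xs → x ∈ ys) →
  length xs ≤ length ys
Unique⇒length-≤ {xs = []}     _          _     = z≤n
Unique⇒length-≤ {xs = x ∷ xs} (x∉xs ∷ u) xs⊆ys with ∈-∃++ (xs⊆ys (here refl))
... | ys₁ , ys₂ , refl =
  ≤-trans (s≤s (Unique⇒length-≤ u xs⊆ys₁++ys₂)) (≤-reflexive (sym (length-++-sucʳ ys₁ x ys₂)))
  where
  xs⊆ys₁++ys₂ : ∀ {y} → y ∈ xs → y ∈ ys₁ ++ ys₂
  xs⊆ys₁++ys₂ p with ∈-++⁻ ys₁ (xs⊆ys (there p))
  ... | inj₁ q           = ∈-++⁺ˡ q
  ... | inj₂ (here refl) = ⊥-elim (All.lookup x∉xs p refl)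
  ... | inj₂ (there q)   = ∈-++⁺ʳ ys₁ q

HasOutDegree-rotations : ∀ k D → HasOutDegree k D (length (rotations k D))
HasOutDegree-rotations k D = rotations k D , rotations-unique k D ,
  (λ D′ → mk⇔ (λ p → Cover⇔Rotation k D D′ .from (rotations-sound k D p))
              (λ c → rotations-complete (Cover⇔Rotation k D D′ .to c))) , refl

HasOutDegree-unique : ∀ k D c → HasOutDegree k D c → c ≡ length (rotations k D)
HasOutDegree-unique k D c (L , L-unique , L⇔covers , refl) = ≤-antisym
  (Unique⇒length-≤ L-unique
    (λ {D′} p → rotations-complete (Cover⇔Rotation k D D′ .to (L⇔covers D′ .to p))))
  (Unique⇒length-≤ (rotations-unique k D)
    (λ {D′} p → L⇔covers D′ .from (Cover⇔Rotation k D D′ .from (rotations-sound k D p))))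

Dyck⇒HasOutDegree-valleys : ∀ k {n D} → Dyck k n D → HasOutDegree k D (valleys D)
Dyck⇒HasOutDegree-valleys k {D = D} d =
  subst (HasOutDegree k D) (length-rotations k D (Dyck⇒SuffixBound k d)) (HasOutDegree-rotations k D)

Dyck-outDegree≡valleys : ∀ k {n D c} → Dyck k n D → HasOutDegree k D c → c ≡ valleys D
Dyck-outDegree≡valleys k {D = D} {c} d h =
  trans (HasOutDegree-unique k D c h) (length-rotations k D (Dyck⇒SuffixBound k d))

Dyck-N∷ : ∀ k {n D} → 1 ≤ n → Dyck k n D → ∃ λ p → D ≡ N ∷ p × #N p ≡ pred n
Dyck-N∷ k {D = []}    (s≤s z≤n) (() , _)
Dyck-N∷ k {D = N ∷ p} (s≤s z≤n) (hN , _)    = p , refl , suc-injective hN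
Dyck-N∷ k {D = E ∷ p} (s≤s z≤n) (_ , _ , h) with subst (1 ≤_) (*-zeroʳ k) (h 1)
... | ()

valleys-∷-≤ : ∀ x p → valleys (x ∷ p) ≤ #N p
valleys-∷-≤ N []      = z≤n
valleys-∷-≤ N (N ∷ p) = m≤n⇒m≤1+n (valleys-∷-≤ N p)
valleys-∷-≤ N (E ∷ p) = valleys-∷-≤ E p
valleys-∷-≤ E []      = z≤n
valleys-∷-≤ E (N ∷ p) = s≤s (valleys-∷-≤ N p)
valleys-∷-≤ E (E ∷ p) = valleys-∷-≤ E p

Dyck-valleys-≤ : ∀ k {n D} → 1 ≤ n → Dyck k n D → valleys D ≤ pred n
Dyck-valleys-≤ k n≥1 d with Dyck-N∷ k n≥1 d
... | p , refl , #Np≡ = subst (valleys (N ∷ p) ≤_) #Np≡ (valleys-∷-≤ N p)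

-- Stretching

stretch : Path → Path
stretch []      = []
stretch (N ∷ p) = N ∷ E ∷ stretch p
stretch (E ∷ p) = E ∷ stretch p

-- Left inverse of stretch; its value on paths that are not Stretched is junk.
unstretch : Path → Path
unstretch []          = []
unstretch (N ∷ E ∷ p) = N ∷ unstretch p
unstretch (x ∷ p)     = x ∷ unstretch p

data Stretched : Path → Set where
  []   : Stretched []
  NE∷_ : ∀ {p} → Stretched p → Stretched (N ∷ E ∷ p)
  E∷_  : ∀ {p} → Stretched p → Stretched (E ∷ p)

unstretch-stretch : ∀ F → unstretch (stretch F) ≡ F
unstretch-stretch []      = refl
unstretch-stretch (N ∷ F) = cong (N ∷_) (unstretch-stretch F)
unstretch-stretch (E ∷ F) = cong (E ∷_) (unstretch-stretch F)

stretch-unstretch : ∀ {D} → Stretched D → stretch (unstretch D) ≡ D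
stretch-unstretch []       = refl
stretch-unstretch (NE∷ s) = cong (λ p → N ∷ E ∷ p) (stretch-unstretch s)
stretch-unstretch (E∷ s)  = cong (E ∷_) (stretch-unstretch s)

Stretched-++ : ∀ {a b} → Stretched a → Stretched b → Stretched (a ++ b)
Stretched-++ []       t = t
Stretched-++ (NE∷ s) t = NE∷ Stretched-++ s t
Stretched-++ (E∷ s)  t = E∷ Stretched-++ s t

unstretch-++ : ∀ {a} → Stretched a → ∀ b → unstretch (a ++ b) ≡ unstretch a ++ unstretch b
unstretch-++ []       b = refl
unstretch-++ (NE∷ s) b = cong (N ∷_) (unstretch-++ s b)
unstretch-++ (E∷ s)  b = cong (E ∷_) (unstretch-++ s b)

#N-stretch : ∀ F → #N (stretch F) ≡ #N F
#N-stretch []      = refl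
#N-stretch (N ∷ F) = cong suc (#N-stretch F)
#N-stretch (E ∷ F) = #N-stretch F

#E-stretch : ∀ F → #E (stretch F) ≡ #E F + #N F
#E-stretch []      = refl
#E-stretch (N ∷ F) = trans (cong suc (#E-stretch F)) (sym (+-suc (#E F) (#N F)))
#E-stretch (E ∷ F) = cong suc (#E-stretch F)

WeaklyAbove : ℕ → ℕ → ℕ → Path → Set
WeaklyAbove k x y []      = x ≤ k * y
WeaklyAbove k x y (N ∷ p) = x ≤ k * y × WeaklyAbove k x (suc y) p
WeaklyAbove k x y (E ∷ p) = x ≤ k * y × WeaklyAbove k (suc x) y p

WeaklyAbove-start : ∀ k x y p → WeaklyAbove k x y p → x ≤ k * y
WeaklyAbove-start k x y []      h       = h
WeaklyAbove-start k x y (N ∷ p) (h , _) = h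
WeaklyAbove-start k x y (E ∷ p) (h , _) = h

WeaklyAbove⇔prefixes : ∀ k x y p →
  WeaklyAbove k x y p ⇔ (∀ j → x + #E (take j p) ≤ k * (y + #N (take j p)))
WeaklyAbove⇔prefixes k x y p = mk⇔ (above⇒prefixes x y p) (prefixes⇒above x y p)
  where
  start : ∀ x y → x ≤ k * y ⇔ x + 0 ≤ k * (y + 0)
  start x y = mk⇔ (subst₂ (λ a b → a ≤ k * b) (sym (+-identityʳ x)) (sym (+-identityʳ y)))
                  (subst₂ (λ a b → a ≤ k * b) (+-identityʳ x) (+-identityʳ y))

  above⇒prefixes : ∀ x y p → WeaklyAbove k x y p → ∀ j → x + #E (take j p) ≤ k * (y + #N (take j p))
  above⇒prefixes x y p h zero = start x y .to (WeaklyAbove-start k x y p h)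
  above⇒prefixes x y [] h (suc j) = start x y .to h
  above⇒prefixes x y (N ∷ p) (_ , h) (suc j) =
    subst (λ b → x + #E (take j p) ≤ k * b) (sym (+-suc y (#N (take j p)))) (above⇒prefixes x (suc y) p h j)
  above⇒prefixes x y (E ∷ p) (_ , h) (suc j) =
    subst (λ a → a ≤ k * (y + #N (take j p))) (sym (+-suc x (#E (take j p)))) (above⇒prefixes (suc x) y p h j)

  prefixes⇒above : ∀ x y p → (∀ j → x + #E (take j p) ≤ k * (y + #N (take j p))) → WeaklyAbove k x y p
  prefixes⇒above x y []      h = start x y .from (h 0)
  prefixes⇒above x y (N ∷ p) h = start x y .from (h 0) , prefixes⇒above x (suc y) p
    (λ j → subst (λ b → x + #E (take j p) ≤ k * b) (+-suc y (#N (take j p))) (h (suc j)))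
  prefixes⇒above x y (E ∷ p) h = start x y .from (h 0) , prefixes⇒above (suc x) y p
    (λ j → subst (λ a → a ≤ k * (y + #N (take j p))) (+-suc x (#E (take j p))) (h (suc j)))

-- Stretching moves the point (x , y) to (x + y , y).
WeaklyAbove-stretch : ∀ k x y F → WeaklyAbove k x y F ⇔ WeaklyAbove (suc k) (x + y) y (stretch F)
WeaklyAbove-stretch k x y F = mk⇔ (to′ x y F) (from′ x y F)
  where
  shift : ∀ x y → x ≤ k * y ⇔ x + y ≤ suc k * y
  shift x y = mk⇔ (λ h → subst (_≤ suc k * y) (+-comm y x) (+-monoʳ-≤ y h))
                  (λ h → +-cancelˡ-≤ y _ _ (subst (_≤ suc k * y) (+-comm x y) h))

  to′ : ∀ x y F → WeaklyAbove k x y F → WeaklyAbove (suc k) (x + y) y (stretch F)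
  to′ x y []      h       = shift x y .to h
  to′ x y (N ∷ F) (h , a) = shift x y .to h ,
    ≤-trans (shift x y .to h) (*-monoʳ-≤ (suc k) (n≤1+n y)) ,
    subst (λ z → WeaklyAbove (suc k) z (suc y) (stretch F)) (+-suc x y) (to′ x (suc y) F a)
  to′ x y (E ∷ F) (h , a) = shift x y .to h , to′ (suc x) y F a

  from′ : ∀ x y F → WeaklyAbove (suc k) (x + y) y (stretch F) → WeaklyAbove k x y F
  from′ x y []      h             = shift x y .from h
  from′ x y (N ∷ F) (h , (_ , a)) = shift x y .from h ,
    from′ x (suc y) F (subst (λ z → WeaklyAbove (suc k) z (suc y) (stretch F)) (sym (+-suc x y)) a)
  from′ x y (E ∷ F) (h , a)       = shift x y .from h , from′ (suc x) y F a

Dyck⇔WeaklyAbove : ∀ k n D → Dyck k n D ⇔ (#N D ≡ n × #E D ≡ k * n × WeaklyAbove k 0 0 D)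
Dyck⇔WeaklyAbove k n D = mk⇔
  (λ (hN , hE , h) → hN , hE , WeaklyAbove⇔prefixes k 0 0 D .from h)
  (λ (hN , hE , h) → hN , hE , WeaklyAbove⇔prefixes k 0 0 D .to h)

Dyck-stretch : ∀ k n F → Dyck k n F ⇔ Dyck (suc k) n (stretch F)
Dyck-stretch k n F = mk⇔
  (λ d → let (hN , hE , h) = Dyck⇔WeaklyAbove k n F .to d in
    Dyck⇔WeaklyAbove (suc k) n (stretch F) .from
      ( trans (#N-stretch F) hN
      , trans (#E-stretch F) (trans (cong₂ _+_ hE hN) (+-comm (k * n) n))
      , WeaklyAbove-stretch k 0 0 F .to h))
  (λ d → let (hN , hE , h) = Dyck⇔WeaklyAbove (suc k) n (stretch F) .to d
             hN′ = trans (sym (#N-stretch F)) hN in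
    Dyck⇔WeaklyAbove k n F .from
      ( hN′
      , +-cancelʳ-≡ n (#E F) (k * n) (trans (cong (λ m → #E F + m) (sym hN′))
          (trans (sym (#E-stretch F)) (trans hE (+-comm n (k * n)))))
      , WeaklyAbove-stretch k 0 0 F .from h))

applyUpTo-cong : ∀ {A : Set} {f g : ℕ → A} → (∀ i → f i ≡ g i) → ∀ n → applyUpTo f n ≡ applyUpTo g n
applyUpTo-cong f≗g zero    = refl
applyUpTo-cong f≗g (suc n) = cong₂ _∷_ (f≗g 0) (applyUpTo-cong (λ i → f≗g (suc i)) n)

-- Stretching shifts the i-th north step of F by j + i, where j counts the north steps read before F.
LA-go-stretch : ∀ x j F → map +_ (LA-go x F) ≡
  zipWith _-_ (map +_ (LA-go (x + j) (stretch F))) (map +_ (applyUpTo (λ i → j + i) (#N F)))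
LA-go-stretch x j []      = refl
LA-go-stretch x j (E ∷ F) = LA-go-stretch (suc x) j F
LA-go-stretch x j (N ∷ F) = cong₂ _∷_ head (begin
  map +_ (LA-go x F)
    ≡⟨ LA-go-stretch x (suc j) F ⟩
  zipWith _-_ (map +_ (LA-go (x + suc j) (stretch F))) (map +_ (applyUpTo (λ i → suc j + i) (#N F)))
    ≡⟨ cong₂ (λ a o → zipWith _-_ (map +_ (LA-go a (stretch F))) (map +_ o))
             (+-suc x j) (applyUpTo-cong (λ i → sym (+-suc j i)) (#N F)) ⟩
  zipWith _-_ (map +_ (LA-go (suc (x + j)) (stretch F))) (map +_ (applyUpTo (λ i → j + suc i) (#N F))) ∎)
  where
  open ≡-Reasoning
  cancel : ∀ a b → (a ℤ.+ b) - b ≡ a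
  cancel = solve-∀
  head : + x ≡ + (x + j) - + (j + 0)
  head = sym (trans (cong₂ (λ a b → a - + b) (pos-+ x j) (+-identityʳ j)) (cancel (+ x) (+ j)))

LAℤ-stretch : ∀ F → LAℤ F ≡ zipWith _-_ (LAℤ (stretch F)) (stairℤ (#N F))
LAℤ-stretch = LA-go-stretch 0 0

-- Paths of maximal out-degree

valleys-E∷stretch : ∀ F → valleys (E ∷ stretch F) ≡ #N F
valleys-E∷stretch []      = refl
valleys-E∷stretch (N ∷ F) = cong suc (valleys-E∷stretch F)
valleys-E∷stretch (E ∷ F) = valleys-E∷stretch F

valleys-stretch : ∀ k {n F} → 1 ≤ n → Dyck k n F → valleys (stretch F) ≡ pred n
valleys-stretch k n≥1 d with Dyck-N∷ k n≥1 d
... | q , refl , #Nq≡ = trans (valleys-E∷stretch q) #Nq≡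

-- Equality in valleys-∷-≤ forces every N but the last to be followed by E, and the
-- suffix bound (k + 1 > 0) rules out a final N.
valleys-tight⇒Stretched : ∀ k x p → SuffixBound (suc k) (x ∷ p) → valleys (x ∷ p) ≡ #N p →
  Stretched (x ∷ p)
valleys-tight⇒Stretched k N []      h _ with h [] (N ∷ []) refl
... | ()
valleys-tight⇒Stretched k N (N ∷ p) _ eq = ⊥-elim (<-irrefl refl (subst (_≤ #N p) eq (valleys-∷-≤ N p)))
valleys-tight⇒Stretched k N (E ∷ p) h eq with valleys-tight⇒Stretched k E p (SuffixBound-∷ (suc k) h) eq
... | E∷ s = NE∷ s
valleys-tight⇒Stretched k E []      _ _  = E∷ []
valleys-tight⇒Stretched k E (N ∷ p) h eq =
  E∷ valleys-tight⇒Stretched k N p (SuffixBound-∷ (suc k) h) (suc-injective eq)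
valleys-tight⇒Stretched k E (E ∷ p) h eq =
  E∷ valleys-tight⇒Stretched k E p (SuffixBound-∷ (suc k) h) eq

vertical-Dyck : ∀ n → Dyck 0 n (replicate n N)
vertical-Dyck n = #N-vertical n , #E-vertical n , prefixes n
  where
  #N-vertical : ∀ n → #N (replicate n N) ≡ n
  #N-vertical zero    = refl
  #N-vertical (suc n) = cong suc (#N-vertical n)
  #E-vertical : ∀ n → #E (replicate n N) ≡ 0
  #E-vertical zero    = refl
  #E-vertical (suc n) = #E-vertical n
  prefixes : ∀ n j → #E (take j (replicate n N)) ≤ 0
  prefixes n       zero    = z≤n
  prefixes zero    (suc j) = z≤n
  prefixes (suc n) (suc j) = prefixes n j

-- N^n stretched k times is ν = (N E^k)^n itself.
someDyckPath : ∀ k n → DPaths k n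
someDyckPath zero    n = replicate n N , vertical-Dyck n
someDyckPath (suc k) n with someDyckPath k n
... | F , d = stretch F , Dyck-stretch k n F .to d

stretch-MaxOutDegree : ∀ k {n F} → 1 ≤ n → Dyck k n F → MaxOutDegree (suc k) n (stretch F)
stretch-MaxOutDegree k {n} {F} n≥1 d =
  d′ , valleys (stretch F) , Dyck⇒HasOutDegree-valleys (suc k) d′ , maximal
  where
  d′ = Dyck-stretch k n F .to d
  maximal : ∀ D′ c′ → Dyck (suc k) n D′ → HasOutDegree (suc k) D′ c′ → c′ ≤ valleys (stretch F)
  maximal D′ c′ dD′ h = begin
    c′          ≡⟨ Dyck-outDegree≡valleys (suc k) dD′ h ⟩
    valleys D′  ≤⟨ Dyck-valleys-≤ (suc k) n≥1 dD′ ⟩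
    pred n      ≡⟨ sym (valleys-stretch k n≥1 d) ⟩
    valleys (stretch F) ∎
    where open ≤-Reasoning

MaxOutDegree⇒Stretched : ∀ k {n D} → 1 ≤ n → MaxOutDegree (suc k) n D → Stretched D
MaxOutDegree⇒Stretched k {n} n≥1 (d , c , h , maximal) with Dyck-N∷ (suc k) n≥1 d
... | p , refl , #Np≡ = valleys-tight⇒Stretched k N p (Dyck⇒SuffixBound (suc k) d)
  (≤-antisym (valleys-∷-≤ N p) (begin
    #N p                ≡⟨ #Np≡ ⟩
    pred n              ≡⟨ sym (valleys-stretch k n≥1 (proj₂ F₀)) ⟩
    valleys (stretch (proj₁ F₀))
                        ≤⟨ maximal _ _ d₀ (Dyck⇒HasOutDegree-valleys (suc k) d₀) ⟩
    c                   ≡⟨ Dyck-outDegree≡valleys (suc k) d h ⟩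
    valleys (N ∷ p)     ∎))
  where
  open ≤-Reasoning
  F₀ = someDyckPath k n
  d₀ = Dyck-stretch k n (proj₁ F₀) .to (proj₂ F₀)

-- Stretching and the Tamari order

FirstReturn-unstretch : ∀ {k e u} → Stretched u → FirstReturn (suc k) e u →
  FirstReturn k e (unstretch u)
FirstReturn-unstretch     []           []               = []
FirstReturn-unstretch {k} (NE∷_ {p} s) (N∷_ {e} (E∷ ρ)) =
  N∷ subst (λ i → FirstReturn k i (unstretch p)) (+-suc e k) (FirstReturn-unstretch s ρ)
FirstReturn-unstretch     (E∷ s)       (E∷ ρ)           = E∷ FirstReturn-unstretch s ρ

-- A first return of slope k + 1 > 0 never ends with N, so it cannot split a pair N E.
FirstReturn-Stretched-split : ∀ {k e u v} → FirstReturn (suc k) e u → Stretched (u ++ E ∷ v) →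
  Stretched u × Stretched v
FirstReturn-Stretched-split []                       (E∷ s)  = [] , s
FirstReturn-Stretched-split (N∷_ {u = E ∷ _} (E∷ ρ)) (NE∷ s) with FirstReturn-Stretched-split ρ s
... | su , sv = NE∷ su , sv
FirstReturn-Stretched-split (E∷ ρ)                   (E∷ s)  with FirstReturn-Stretched-split ρ s
... | su , sv = E∷ su , sv

Rotation-unstretch : ∀ {k D D′} → Rotation (suc k) D D′ → Stretched D′ →
  Stretched D × Rotation k (unstretch D) (unstretch D′)
Rotation-unstretch {k} (here {E ∷ u} {v} (E∷ ρ)) (NE∷ s) with FirstReturn-Stretched-split ρ s
... | su , sv = E∷ NE∷ Stretched-++ su sv ,
  subst₂ (Rotation k) (cong (λ p → E ∷ N ∷ p) (sym (unstretch-++ su v)))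
                      (cong (N ∷_) (sym (unstretch-++ su (E ∷ v))))
                      (here (FirstReturn-unstretch su ρ))
Rotation-unstretch (N ∷ (E ∷ ρ)) (NE∷ s) with Rotation-unstretch ρ s
... | sD , ρ′ = NE∷ sD , N ∷ ρ′
Rotation-unstretch (E ∷ ρ) (E∷ s) with Rotation-unstretch ρ s
... | sD , ρ′ = E∷ sD , E ∷ ρ′

TamariLeq-unstretch : ∀ k {D D′} → TamariLeq (suc k) D D′ → Stretched D′ →
  Stretched D × TamariLeq k (unstretch D) (unstretch D′)
TamariLeq-unstretch k ε s = s , ε
TamariLeq-unstretch k (D⋖P ◅ P≤D′) s with TamariLeq-unstretch k P≤D′ s
... | sP , P≤D′-unstretched with Rotation-unstretch (Cover⇔Rotation (suc k) _ _ .to D⋖P) sP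
...   | sD , ρ = sD , Cover⇔Rotation k _ _ .from ρ ◅ P≤D′-unstretched

mainTheorem9 : (m n : ℕ) → 1 ≤ m → 1 ≤ n →
    Σ (DOut m n → DPaths (m ∸ 1) n) λ φ →
      (∀ D → LAℤ (proj₁ (φ D)) ≡ zipWith _-_ (LAℤ (proj₁ D)) (stairℤ n)) ×
      (∀ D₁ D₂ → proj₁ (φ D₁) ≡ proj₁ (φ D₂) → proj₁ D₁ ≡ proj₁ D₂) ×
      (∀ (F : DPaths (m ∸ 1) n) → ∃ λ (D : DOut m n) → proj₁ (φ D) ≡ proj₁ F) ×
      (∀ D₁ D₂ → TamariLeq m (proj₁ D₁) (proj₁ D₂) →
        TamariLeq (m ∸ 1) (proj₁ (φ D₁)) (proj₁ (φ D₂)))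
mainTheorem9 zero    n ()  _
mainTheorem9 (suc k) n _ n≥1 = φ , leftArea , injective , surjective , monotone
  where
  stretched : ∀ (D : DOut (suc k) n) → Stretched (proj₁ D)
  stretched (_ , max) = MaxOutDegree⇒Stretched k n≥1 max

  φ : DOut (suc k) n → DPaths k n
  φ D = unstretch (proj₁ D) , Dyck-stretch k n _ .from
    (subst (Dyck (suc k) n) (sym (stretch-unstretch (stretched D))) (proj₁ (proj₂ D)))

  leftArea : ∀ D → LAℤ (proj₁ (φ D)) ≡ zipWith _-_ (LAℤ (proj₁ D)) (stairℤ n)
  leftArea D = trans (LAℤ-stretch (proj₁ (φ D))) (cong₂ (λ X h → zipWith _-_ (LAℤ X) (stairℤ h))
    (stretch-unstretch (stretched D)) (proj₁ (proj₂ (φ D))))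

  injective : ∀ D₁ D₂ → proj₁ (φ D₁) ≡ proj₁ (φ D₂) → proj₁ D₁ ≡ proj₁ D₂
  injective D₁ D₂ eq = trans (sym (stretch-unstretch (stretched D₁)))
    (trans (cong stretch eq) (stretch-unstretch (stretched D₂)))

  surjective : ∀ (F : DPaths k n) → ∃ λ (D : DOut (suc k) n) → proj₁ (φ D) ≡ proj₁ F
  surjective (F , d) = (stretch F , stretch-MaxOutDegree k n≥1 d) , unstretch-stretch F

  monotone : ∀ D₁ D₂ → TamariLeq (suc k) (proj₁ D₁) (proj₁ D₂) →
    TamariLeq k (proj₁ (φ D₁)) (proj₁ (φ D₂))
  monotone D₁ D₂ D₁≤D₂ = proj₂ (TamariLeq-unstretch k D₁≤D₂ (stretched D₂))
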